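{- Let $n\ge5$ be odd, $T=\langle n,3n-2,3n-1\rangle$, $\mathrm F(T)=\max(\mathbb Z\setminus T)$ and $S=T\cup\{\mathrm F(T)\}$. Let $i$ be a positive integer and $s,s'\in M_i$. Then the following are equivalent: 1) $\mathrm{nf}(s')<\mathrm{nf}(s)$; 2) for every factorization $\zeta\in\mathsf Z(s)$ there exists a unique $\zeta'\in\mathsf Z(s')$ with $\zeta'<\zeta$.
   Context: For $m\in S\setminus\{0\}$, $\mathrm{Ap}(S,m)=\{s\in S: s-m\notin S\}$. For $s\in\mathrm{Ap}(S,\mathrm F(T))$ (such $s$ lie in $T$), $\mathsf Z(s)=\{(x,y,z)\in\mathbb N^3: xn+y(3n-2)+z(3n-1)=s\}$, and $\mathrm{nf}(s)$ is the unique element $(x,y,z)\in\mathsf Z(s)$ with $z<2$, $y<\frac{n+1}{2}$, $x<\frac{3n-1}{2}$. $M_i=\{s\in\mathrm{Ap}(S,\mathrm F(T)): \#\mathsf Z(s)=i\}$. The order $<$ on $\mathbb N^3$ is the strict componentwise partial order ($u<v$ iff $u\le v$ componentwise and $u\ne v$). -}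

module Defs where

open import Data.Nat using (ℕ; zero; suc; _+_; _*_; _∸_; _≤_; _<_; _≟_)
open import Data.Product using (Σ; _×_; _,_; ∃)
open import Data.List using (List; []; _∷_; length; filter; concatMap; map; upTo)
open import Data.Sum using (_⊎_)
open import Relation.Nullary using (¬_)
open import Relation.Binary.PropositionalEquality using (_≡_)

Triple : Set
Triple = ℕ × ℕ × ℕ

ev : ℕ → Triple → ℕ
ev n (x , y , z) = x * n + y * (3 * n ∸ 2) + z * (3 * n ∸ 1)

IsFact : ℕ → ℕ → Triple → Set
IsFact n s t = ev n t ≡ s

InT : ℕ → ℕ → Set
InT n m = ∃ λ t → IsFact n m t

-- f is the Frobenius number of T: f ∉ T and every integer > f is in T
-- (negative integers are never in T; here f is taken in ℕ since 1 ∉ T)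
IsFrobenius : ℕ → ℕ → Set
IsFrobenius n f = ¬ InT n f × (∀ m → f < m → InT n m)

InS : ℕ → ℕ → ℕ → Set
InS n f m = InT n m ⊎ (m ≡ f)

-- s ∈ Ap(S, F(T)):  s ∈ S and s - F(T) ∉ S (s - F(T) < 0 is never in S)
InAp : ℕ → ℕ → ℕ → Set
InAp n f s = InS n f s × ¬ (f ≤ s × InS n f (s ∸ f))

-- all triples with coordinates ≤ s (contains 𝖹(s) since n ≥ 1)
triples : ℕ → List Triple
triples s = concatMap (λ x → concatMap (λ y → map (λ z → (x , y , z)) (upTo (suc s))) (upTo (suc s))) (upTo (suc s))

factList : ℕ → ℕ → List Triple
factList n s = filter (λ t → ev n t ≟ s) (triples s)

numFact : ℕ → ℕ → ℕ
numFact n s = length (factList n s)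

InM : ℕ → ℕ → ℕ → ℕ → Set
InM n f i s = InAp n f s × numFact n s ≡ i

IsNF : ℕ → ℕ → Triple → Set
IsNF n s (x , y , z) = IsFact n s (x , y , z) × z < 2 × 2 * y < n + 1 × 2 * x < 3 * n ∸ 1

_≤₃_ : Triple → Triple → Set
(x , y , z) ≤₃ (x' , y' , z') = x ≤ x' × y ≤ y' × z ≤ z'

_<₃_ : Triple → Triple → Set
u <₃ v = u ≤₃ v × ¬ (u ≡ v)

-- Write n = 2k + 1 and factorizations as (a, b, c). Since 3n − 2 ≡ −2 and 3n − 1 ≡ −1 (mod n),
-- comparing a factorization of s with nf(s) modulo n and by size shows that it arises from nf(s)
-- by a single trade: j-fold use of 3g₁ + g₂ = 2g₃, or one of g₃ + (3k − 1)g₁ = (k + 1)g₂ and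
-- kg₂ + g₃ = (3k + 2)g₁. Hence #𝖹(s) is the number of exchanges available at nf(s) plus two 0/1
-- flags, each monotone in nf(s). If nf(s′) < nf(s) and #𝖹(s′) = #𝖹(s), all three summands agree,
-- so every trade applicable to nf(s) also applies to nf(s′), and applying it there gives the unique
-- factorization of s′ below the corresponding factorization of s. Conversely, the factorization of
-- s′ below nf(s) must be nf(s′) itself, since every other factorization of s′ leaves the box of
-- normal forms.

module Submission where

open import Defs
open import Data.Nat
open import Data.Nat.Properties
open import Data.Nat.Tactic.RingSolver using (solve-∀; solve)
open import Data.List using (List; []; _∷_; _++_; length; concatMap; map; upTo)
open import Data.List.Properties using (length-++)
open import Data.List.Membership.Propositional using (_∈_; find; lose)
open import Data.List.Membership.Propositional.Properties
  using (∈-map⁺; ∈-map⁻; ∈-concatMap⁺; ∈-concatMap⁻; ∈-upTo⁺; ∈-filter⁺; ∈-filter⁻; ∈-++⁺ˡ; ∈-++⁺ʳ; ∈-++⁻; ∈-length)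
open import Data.List.Membership.Propositional.Properties.WithK using (unique∧set⇒bag)
open import Data.List.Relation.Binary.BagAndSetEquality using (∼bag⇒↭)
open import Data.List.Relation.Binary.Permutation.Propositional.Properties using (↭-length)
open import Data.List.Relation.Unary.Any using (here; there)
open import Data.List.Relation.Unary.All using (tabulate; [])
open import Data.List.Relation.Unary.All.Properties using (All¬⇒¬Any)
open import Data.List.Relation.Unary.AllPairs using ([]; _∷_)
open import Data.List.Relation.Unary.Unique.Propositional using (Unique)
open import Data.List.Relation.Unary.Unique.Propositional.Properties using (++⁺; map⁺; filter⁺; upTo⁺)
open import Data.Product using (Σ; ∃-syntax; _×_; _,_; proj₁; proj₂)
open import Data.Product.Properties using (,-injectiveˡ; ,-injectiveʳ)
open import Data.Empty using (⊥; ⊥-elim)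
open import Data.Sum using (inj₁; inj₂)
open import Function.Bundles using (_⇔_; mk⇔; Equivalence)
open import Relation.Binary.PropositionalEquality
open import Relation.Binary.Definitions using (tri<; tri≈; tri>)
open import Relation.Nullary using (¬_; yes; no)

-- Factorizations modulo n

weight : Triple → ℕ
weight (a , b , c) = a + 3 * b + 3 * c

residue : Triple → ℕ
residue (a , b , c) = 2 * b + c

ev+residue≡weight*n : ∀ m t → ev (suc m) t + residue t ≡ weight t * suc m
ev+residue≡weight*n m (a , b , c) = begin
    a * n + b * (3 * n ∸ 2) + c * (3 * n ∸ 1) + (2 * b + c)
  ≡⟨ distribute a b c n (3 * n ∸ 2) (3 * n ∸ 1) ⟩
    a * n + b * (3 * n ∸ 2 + 2) + c * (3 * n ∸ 1 + 1)
  ≡⟨ cong₂ (λ p q → a * n + b * p + c * q) (m∸n+n≡m 2≤3n) (m∸n+n≡m 1≤3n) ⟩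
    a * n + b * (3 * n) + c * (3 * n)
  ≡⟨ collect a b c n ⟩
    weight (a , b , c) * n ∎
  where
  open ≡-Reasoning
  n = suc m
  distribute : ∀ a b c n P Q → a * n + b * P + c * Q + (2 * b + c) ≡ a * n + b * (P + 2) + c * (Q + 1)
  distribute = solve-∀
  collect : ∀ a b c n → a * n + b * (3 * n) + c * (3 * n) ≡ (a + 3 * b + 3 * c) * n
  collect = solve-∀
  2≤3n : 2 ≤ 3 * n
  2≤3n = ≤-trans (n≤1+n 2) (*-monoʳ-≤ 3 (s≤s (z≤n {m})))
  1≤3n : 1 ≤ 3 * n
  1≤3n = ≤-trans (n≤1+n 1) 2≤3n

shift-≡ : ∀ {p q r s P Q} → p + r ≡ P → q + s ≡ Q → (p ≡ q ⇔ P + s ≡ Q + r)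
shift-≡ {p} {q} {r} {s} refl refl = mk⇔ to from
  where
  swap : ∀ q r s → q + r + s ≡ q + s + r
  swap = solve-∀
  to : p ≡ q → p + r + s ≡ q + s + r
  to refl = swap p r s
  from : p + r + s ≡ q + s + r → p ≡ q
  from e = +-cancelʳ-≡ (r + s) p q (trans (sym (+-assoc p r s)) (trans e (trans (swap q s r) (+-assoc q r s))))

ev≡⇔cross : ∀ m t u → (ev (suc m) t ≡ ev (suc m) u ⇔ weight t * suc m + residue u ≡ weight u * suc m + residue t)
ev≡⇔cross m t u = shift-≡ (ev+residue≡weight*n m t) (ev+residue≡weight*n m u)

2*-injective : ∀ a b → 2 * a ≡ 2 * b → a ≡ b
2*-injective a b = *-cancelˡ-≡ a b 2

cancel-2* : ∀ c p q → c + 2 * p ≡ c + 2 * q → p ≡ q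
cancel-2* c p q e = 2*-injective p q (+-cancelˡ-≡ c _ _ e)

2*m+n≡0⇒m≡0×n≡0 : ∀ m n → 2 * m + n ≡ 0 → m ≡ 0 × n ≡ 0
2*m+n≡0⇒m≡0×n≡0 b c e = 2*-injective b 0 (m+n≡0⇒m≡0 (2 * b) e) , m+n≡0⇒n≡0 (2 * b) e

parity-split : ∀ b c y w → w ≤ 1 → 2 * b + c ≡ 2 * y + w → ∃[ j ] c ≡ w + 2 * j × y ≡ b + j
parity-split b 0 y 0 _ e =
  0 , refl , trans (2*-injective y b (sym (trans (sym (+-identityʳ (2 * b))) (trans e (+-identityʳ (2 * y)))))) (sym (+-identityʳ b))
parity-split b 0 y 1 _ e = ⊥-elim (even≢odd b y (trans (sym (+-identityʳ (2 * b))) (trans e (+-comm (2 * y) 1))))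
parity-split b 1 y 0 _ e = ⊥-elim (even≢odd y b (trans (sym (+-identityʳ (2 * y))) (trans (sym e) (+-comm (2 * b) 1))))
parity-split b 1 y 1 _ e = 0 , refl , trans (2*-injective y b (sym (+-cancelʳ-≡ 1 (2 * b) (2 * y) e))) (sym (+-identityʳ b))
parity-split b 0 y (suc (suc w)) (s≤s ()) e
parity-split b 1 y (suc (suc w)) (s≤s ()) e
parity-split b (suc (suc c)) y w w≤1 e with parity-split (suc b) c y w w≤1 (trans (shift b c) e)
  where
  shift : ∀ b c → 2 * suc b + c ≡ 2 * b + suc (suc c)
  shift = solve-∀
... | j , refl , refl = suc j , shift w j , sym (+-suc b j)
  where
  shift : ∀ w j → suc (suc (w + 2 * j)) ≡ w + 2 * suc j
  shift = solve-∀

data QuotientGap (n A B σ ρ : ℕ) : Set where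
  one-less    : B ≡ suc A → σ ≡ n → ρ ≡ 0 → QuotientGap n A B σ ρ
  equal       : A ≡ B → σ ≡ ρ → QuotientGap n A B σ ρ
  one-more    : A ≡ suc B → ρ ≡ n + σ → QuotientGap n A B σ ρ
  two-or-more : ∀ q → A ≡ 2 + q + B → ρ ≡ (2 + q) * n + σ → QuotientGap n A B σ ρ

compare-quotients : ∀ m A B σ ρ → σ ≤ suc m → A * suc m + σ ≡ B * suc m + ρ → QuotientGap (suc m) A B σ ρ
compare-quotients m A B σ ρ σ≤n e with <-cmp A B
... | tri≈ _ refl _ = equal refl (+-cancelˡ-≡ (A * suc m) σ ρ e)
... | tri< A<B _ _ with m≤n⇒∃[o]m+o≡n A<B
...   | d , refl = one-less (cong suc (trans (cong (A +_) d≡0) (+-identityʳ A))) σ≡n ρ≡0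
  where
  n = suc m
  σ≡n+rest : σ ≡ n + (d * n + ρ)
  σ≡n+rest = +-cancelˡ-≡ (A * n) _ _ (trans e (expand A d n ρ))
    where
    expand : ∀ A d n ρ → (suc A + d) * n + ρ ≡ A * n + (n + (d * n + ρ))
    expand = solve-∀
  rest≡0 : d * n + ρ ≡ 0
  rest≡0 = n≤0⇒n≡0 (+-cancelˡ-≤ n _ 0 (subst (_≤ n + 0) σ≡n+rest (subst (σ ≤_) (sym (+-identityʳ n)) σ≤n)))
  d≡0 : d ≡ 0
  d≡0 = m*n≡0⇒m≡0 d n (m+n≡0⇒m≡0 (d * n) rest≡0)
  ρ≡0 : ρ ≡ 0
  ρ≡0 = m+n≡0⇒n≡0 (d * n) rest≡0
  σ≡n : σ ≡ n
  σ≡n = trans σ≡n+rest (trans (cong (n +_) rest≡0) (+-identityʳ n))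
compare-quotients m A B σ ρ σ≤n e | tri> _ _ B<A with m≤n⇒∃[o]m+o≡n B<A
... | zero , refl = one-more (cong suc (+-identityʳ B)) (+-cancelˡ-≡ (B * suc m) _ _ (trans (sym e) (expand B σ m)))
  where
  expand : ∀ B σ m → (suc B + 0) * suc m + σ ≡ B * suc m + (suc m + σ)
  expand = solve-∀
... | suc q , refl = two-or-more q (trans (+-comm (suc B) (suc q)) (cong suc (+-suc q B))) (+-cancelˡ-≡ (B * suc m) _ _ (trans (sym e) (expand B q σ m)))
  where
  expand : ∀ B q σ m → (suc B + suc q) * suc m + σ ≡ B * suc m + ((2 + q) * suc m + σ)
  expand = solve-∀

-- 2a + 3c: the combination of weight and residue in which b cancels.
slack : Triple → ℕ
slack (a , b , c) = 2 * a + 3 * c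

slack-shift : ∀ t u d r → weight t ≡ d + weight u → residue t ≡ r + residue u → slack t + 3 * r ≡ 2 * d + slack u
slack-shift (a , b , c) (x , y , z) d r ew er = +-cancelʳ-≡ (3 * residue (x , y , z)) _ _ (begin
    slack (a , b , c) + 3 * r + 3 * residue (x , y , z)  ≡⟨ regroup (slack (a , b , c)) r (residue (x , y , z)) ⟩
    slack (a , b , c) + 3 * (r + residue (x , y , z))    ≡⟨ cong (λ v → slack (a , b , c) + 3 * v) (sym er) ⟩
    slack (a , b , c) + 3 * residue (a , b , c)          ≡⟨ twice-weight a b c ⟩
    2 * weight (a , b , c)                               ≡⟨ cong (2 *_) ew ⟩
    2 * (d + weight (x , y , z))                         ≡⟨ expand d x y z ⟩
    2 * d + slack (x , y , z) + 3 * residue (x , y , z)  ∎)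
  where
  open ≡-Reasoning
  regroup : ∀ s r ρ → s + 3 * r + 3 * ρ ≡ s + 3 * (r + ρ)
  regroup = solve-∀
  twice-weight : ∀ a b c → 2 * a + 3 * c + 3 * (2 * b + c) ≡ 2 * (a + 3 * b + 3 * c)
  twice-weight = solve-∀
  expand : ∀ d x y z → 2 * (d + (x + 3 * y + 3 * z)) ≡ 2 * d + (2 * x + 3 * z) + 3 * (2 * y + z)
  expand = solve-∀

-- Trades

-- The bounds z < 2, y < (n + 1)/2, x < (3n − 1)/2 of a normal form, for n = 2k + 1.
Reduced : ℕ → Triple → Set
Reduced k (x , y , z) = x ≤ 3 * k × y ≤ k × z ≤ 1

-- Exchange, Into₂ and Into₁ apply 3g₁ + g₂ = 2g₃ (j times), g₃ + (3k − 1)g₁ = (k + 1)g₂ and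
-- kg₂ + g₃ = (3k + 2)g₁ respectively, where g₁ = n, g₂ = 3n − 2, g₃ = 3n − 1.
Exchange : Triple → Triple → Set
Exchange (x , y , z) (a , b , c) = ∃[ j ] x ≡ a + 3 * j × y ≡ b + j × c ≡ z + 2 * j

Into₂ : ℕ → Triple → Triple → Set
Into₂ k (x , y , z) (a , b , c) = z ≡ 1 × c ≡ 0 × x + 1 ≡ a + 3 * k × b ≡ y + k + 1

Into₁ : ℕ → Triple → Triple → Set
Into₁ k (x , y , z) (a , b , c) = y ≡ k × z ≡ 1 × b ≡ 0 × c ≡ 0 × a ≡ x + 3 * k + 2

data Trade (k : ℕ) (u t : Triple) : Set where
  exchange : Exchange u t → Trade k u t
  into₂    : Into₂ k u t → Trade k u t
  into₁    : Into₁ k u t → Trade k u t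

trade⇒cross : ∀ {k u t} → Trade k u t → weight t * suc (2 * k) + residue u ≡ weight u * suc (2 * k) + residue t
trade⇒cross {k} {_ , _ , z} {a , b , _} (exchange (j , refl , refl , refl)) = identity a b z j k
  where
  identity : ∀ a b z j k → (a + 3 * b + 3 * (z + 2 * j)) * suc (2 * k) + (2 * (b + j) + z)
                         ≡ (a + 3 * j + 3 * (b + j) + 3 * z) * suc (2 * k) + (2 * b + (z + 2 * j))
  identity = solve-∀
trade⇒cross {k} {x , y , _} {a , _ , _} (into₂ (refl , refl , e , refl)) = begin
    (a + 3 * (y + k + 1) + 3 * 0) * suc (2 * k) + (2 * y + 1) ≡⟨ regroup a y k ⟩
    ((a + 3 * k) + 3 * y + 3) * suc (2 * k) + (2 * y + 1)     ≡⟨ cong (λ v → (v + 3 * y + 3) * suc (2 * k) + (2 * y + 1)) (sym e) ⟩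
    ((x + 1) + 3 * y + 3) * suc (2 * k) + (2 * y + 1)         ≡⟨ expand x y k ⟩
    (x + 3 * y + 3 * 1) * suc (2 * k) + (2 * (y + k + 1) + 0) ∎
  where
  open ≡-Reasoning
  regroup : ∀ a y k → (a + 3 * (y + k + 1) + 3 * 0) * suc (2 * k) + (2 * y + 1) ≡ ((a + 3 * k) + 3 * y + 3) * suc (2 * k) + (2 * y + 1)
  regroup = solve-∀
  expand : ∀ x y k → ((x + 1) + 3 * y + 3) * suc (2 * k) + (2 * y + 1) ≡ (x + 3 * y + 3 * 1) * suc (2 * k) + (2 * (y + k + 1) + 0)
  expand = solve-∀
trade⇒cross {k} {x , _ , _} {_ , _ , _} (into₁ (refl , refl , refl , refl , refl)) = identity x k
  where
  identity : ∀ x k → (x + 3 * k + 2 + 3 * 0 + 3 * 0) * suc (2 * k) + (2 * k + 1) ≡ (x + 3 * k + 3 * 1) * suc (2 * k) + (2 * 0 + 0)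
  identity = solve-∀

trade-of-one-less : ∀ k a b c x y z → z ≤ 1 → weight (x , y , z) ≡ suc (weight (a , b , c)) →
                    residue (x , y , z) ≡ suc (2 * k) → residue (a , b , c) ≡ 0 → Trade k (x , y , z) (a , b , c)
trade-of-one-less k a b c x y z z≤1 ew eρu eρt
  with 2*m+n≡0⇒m≡0×n≡0 b c eρt | parity-split y z k 1 ≤-refl (trans eρu (+-comm 1 (2 * k)))
... | refl , refl | zero , refl , k≡y+0 = into₁ (sym (trans k≡y+0 (+-identityʳ y)) , refl , refl , refl , a≡x+3k+2)
  where
  slack-eq : slack (x , y , 1) + 3 * suc (2 * k) ≡ 2 * 1 + slack (a , 0 , 0)
  slack-eq = slack-shift (x , y , 1) (a , 0 , 0) 1 (suc (2 * k)) ew (trans eρu (sym (+-identityʳ _)))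
  a≡x+3k+2 : a ≡ x + 3 * k + 2
  a≡x+3k+2 = cancel-2* 2 a _ (begin
    2 + 2 * a                                ≡⟨ solve (a ∷ []) ⟩
    2 * 1 + (2 * a + 3 * 0)                  ≡⟨ sym slack-eq ⟩
    2 * x + 3 * 1 + 3 * suc (2 * k)          ≡⟨ solve (x ∷ k ∷ []) ⟩
    2 + 2 * (x + 3 * k + 2)                  ∎)
    where open ≡-Reasoning
... | refl , refl | suc _ , refl , _ with z≤1
...   | s≤s ()

trade-of-same : ∀ k a b c x y z → z ≤ 1 → weight (a , b , c) ≡ weight (x , y , z) →
                residue (x , y , z) ≡ residue (a , b , c) → Trade k (x , y , z) (a , b , c)
trade-of-same k a b c x y z z≤1 ew eρ with parity-split b c y z z≤1 (sym eρ)
... | j , refl , y≡b+j = exchange (j , x≡a+3j , y≡b+j , refl)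
  where
  slack-eq : slack (a , b , z + 2 * j) + 3 * 0 ≡ 2 * 0 + slack (x , y , z)
  slack-eq = slack-shift (a , b , z + 2 * j) (x , y , z) 0 0 ew (sym eρ)
  x≡a+3j : x ≡ a + 3 * j
  x≡a+3j = cancel-2* (3 * z) x _ (begin
    3 * z + 2 * x                        ≡⟨ solve (x ∷ z ∷ []) ⟩
    2 * 0 + (2 * x + 3 * z)              ≡⟨ sym slack-eq ⟩
    2 * a + 3 * (z + 2 * j) + 3 * 0      ≡⟨ solve (a ∷ z ∷ j ∷ []) ⟩
    3 * z + 2 * (a + 3 * j)              ∎)
    where open ≡-Reasoning

no-second-exchange : ∀ k a x j → x ≤ 3 * k → x + 1 ≡ a + 3 * j + 3 * k → j ≡ 0
no-second-exchange k a x zero _ _ = refl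
no-second-exchange k a x (suc i) x≤3k x+1≡ = ⊥-elim (m+1+n≰m (3 * k) (subst (_≤ 3 * k) x≡ x≤3k))
  where
  x≡ : x ≡ 3 * k + suc (suc (a + 3 * i))
  x≡ = +-cancelʳ-≡ 1 x _ (trans x+1≡ (solve (a ∷ i ∷ k ∷ [])))

trade-of-one-more : ∀ k a b c x y z → x ≤ 3 * k → z ≤ 1 → weight (a , b , c) ≡ suc (weight (x , y , z)) →
                    residue (a , b , c) ≡ suc (2 * k) + residue (x , y , z) → Trade k (x , y , z) (a , b , c)
trade-of-one-more k a b c x y 0 x≤3k _ ew eρ
  with parity-split b c (k + y) 1 (s≤s z≤n) (trans eρ (regroup k y))
  where
  regroup : ∀ k y → suc (2 * k) + (2 * y + 0) ≡ 2 * (k + y) + 1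
  regroup = solve-∀
... | j , refl , _ = ⊥-elim (m+1+n≰m (3 * k) (subst (_≤ 3 * k) x≡ x≤3k))
  where
  slack-eq : slack (a , b , 1 + 2 * j) + 3 * suc (2 * k) ≡ 2 * 1 + slack (x , y , 0)
  slack-eq = slack-shift (a , b , 1 + 2 * j) (x , y , 0) 1 (suc (2 * k)) ew eρ
  x≡ : x ≡ 3 * k + suc (suc (a + 3 * j))
  x≡ = cancel-2* 2 x _ (begin
    2 + 2 * x                                          ≡⟨ solve (x ∷ []) ⟩
    2 * 1 + (2 * x + 3 * 0)                            ≡⟨ sym slack-eq ⟩
    2 * a + 3 * (1 + 2 * j) + 3 * suc (2 * k)          ≡⟨ solve (a ∷ j ∷ k ∷ []) ⟩
    2 + 2 * (3 * k + suc (suc (a + 3 * j)))            ∎)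
    where open ≡-Reasoning
trade-of-one-more k a b c x y 1 x≤3k _ ew eρ
  with parity-split b c (y + k + 1) 0 z≤n (trans eρ (regroup k y))
  where
  regroup : ∀ k y → suc (2 * k) + (2 * y + 1) ≡ 2 * (y + k + 1) + 0
  regroup = solve-∀
... | j , refl , y+k+1≡b+j =
  into₂ (refl , cong (2 *_) j≡0 , trans x+1≡a+3j+3k (trans (cong (λ v → a + 3 * v + 3 * k) j≡0) (cong (_+ 3 * k) (+-identityʳ a))) ,
         sym (trans y+k+1≡b+j (trans (cong (b +_) j≡0) (+-identityʳ b))))
  where
  slack-eq : slack (a , b , 0 + 2 * j) + 3 * suc (2 * k) ≡ 2 * 1 + slack (x , y , 1)
  slack-eq = slack-shift (a , b , 0 + 2 * j) (x , y , 1) 1 (suc (2 * k)) ew eρ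
  x+1≡a+3j+3k : x + 1 ≡ a + 3 * j + 3 * k
  x+1≡a+3j+3k = cancel-2* 3 (x + 1) (a + 3 * j + 3 * k) (begin
    3 + 2 * (x + 1)                                    ≡⟨ solve (x ∷ []) ⟩
    2 * 1 + (2 * x + 3 * 1)                            ≡⟨ sym slack-eq ⟩
    2 * a + 3 * (0 + 2 * j) + 3 * suc (2 * k)          ≡⟨ solve (a ∷ j ∷ k ∷ []) ⟩
    3 + 2 * (a + 3 * j + 3 * k)                        ∎)
    where open ≡-Reasoning
  j≡0 : j ≡ 0
  j≡0 = no-second-exchange k a x j x≤3k x+1≡a+3j+3k
trade-of-one-more k a b c x y (suc (suc z)) _ (s≤s ()) ew eρ

two-or-more-impossible : ∀ k a b c x y z q → 1 ≤ k → x ≤ 3 * k → z ≤ 1 → weight (a , b , c) ≡ 2 + q + weight (x , y , z) →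
                         residue (a , b , c) ≡ (2 + q) * suc (2 * k) + residue (x , y , z) → ⊥
two-or-more-impossible zero a b c x y z q () x≤3k z≤1 ew eρ
two-or-more-impossible k@(suc k′) a b c x y z q _ x≤3k z≤1 ew eρ = <-irrefl refl (begin-strict
    2 * (2 + q) + slack (x , y , z)          ≤⟨ +-monoʳ-≤ (2 * (2 + q)) (+-mono-≤ (*-monoʳ-≤ 2 x≤3k) (*-monoʳ-≤ 3 z≤1)) ⟩
    2 * (2 + q) + (2 * (3 * k) + 3 * 1)      <⟨ ≤-trans (m≤m+n _ (4 + 6 * k′ + 7 * q + 6 * k′ * q)) (≤-reflexive (gap q k′)) ⟩
    3 * ((2 + q) * n)                        ≤⟨ m≤n+m _ (slack (a , b , c)) ⟩
    slack (a , b , c) + 3 * ((2 + q) * n)    ≡⟨ slack-shift (a , b , c) (x , y , z) (2 + q) ((2 + q) * n) ew eρ ⟩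
    2 * (2 + q) + slack (x , y , z)          ∎)
  where
  open ≤-Reasoning
  n = suc (2 * k)
  gap : ∀ q k′ → suc (2 * (2 + q) + (2 * (3 * suc k′) + 3 * 1)) + (4 + 6 * k′ + 7 * q + 6 * k′ * q)
               ≡ 3 * ((2 + q) * suc (2 * suc k′))
  gap = solve-∀

cross⇒trade : ∀ k t u → 1 ≤ k → Reduced k u →
              weight t * suc (2 * k) + residue u ≡ weight u * suc (2 * k) + residue t → Trade k u t
cross⇒trade k (a , b , c) (x , y , z) k≥1 (x≤3k , y≤k , z≤1) e
  with compare-quotients (2 * k) (weight (a , b , c)) (weight (x , y , z)) (residue (x , y , z)) (residue (a , b , c)) residue≤n e
  where
  residue≤n : 2 * y + z ≤ suc (2 * k)
  residue≤n = subst (2 * y + z ≤_) (+-comm (2 * k) 1) (+-mono-≤ (*-monoʳ-≤ 2 y≤k) z≤1)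
... | one-less ew eσ eρ     = trade-of-one-less k a b c x y z z≤1 ew eσ eρ
... | equal ew eρ           = trade-of-same k a b c x y z z≤1 ew eρ
... | one-more ew eρ        = trade-of-one-more k a b c x y z x≤3k z≤1 ew eρ
... | two-or-more q ew eρ   = ⊥-elim (two-or-more-impossible k a b c x y z q k≥1 x≤3k z≤1 ew eρ)

trade⇒ev≡ : ∀ {k u t} → Trade k u t → ev (suc (2 * k)) t ≡ ev (suc (2 * k)) u
trade⇒ev≡ {k} {u} {t} τ = Equivalence.from (ev≡⇔cross (2 * k) t u) (trade⇒cross τ)

ev≡⇒trade : ∀ k t u → 1 ≤ k → Reduced k u → ev (suc (2 * k)) t ≡ ev (suc (2 * k)) u → Trade k u t
ev≡⇒trade k t u k≥1 red e = cross⇒trade k t u k≥1 red (Equivalence.to (ev≡⇔cross (2 * k) t u) e)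

-- Counting factorizations

concatMap-unique : ∀ {A B : Set} (key : B → A) (f : A → List B) {xs} → Unique xs → (∀ x → Unique (f x)) →
                   (∀ x {b} → b ∈ f x → key b ≡ x) → Unique (concatMap f xs)
concatMap-unique key f {[]} [] _ _ = []
concatMap-unique key f {x ∷ xs} (x∉xs ∷ xs!) f! key-f = ++⁺ (f! x) (concatMap-unique key f xs! f! key-f) disjoint
  where
  disjoint : ∀ {b} → ¬ (b ∈ f x × b ∈ concatMap f xs)
  disjoint (b∈fx , b∈rest) with x′ , x′∈xs , b∈fx′ ← find (∈-concatMap⁻ f {xs = xs} b∈rest) =
    All¬⇒¬Any x∉xs (subst (_∈ xs) (trans (sym (key-f x′ b∈fx′)) (key-f x b∈fx)) x′∈xs)

triples-unique : ∀ s → Unique (triples s)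
triples-unique s = concatMap-unique proj₁ plane (upTo⁺ (suc s)) plane-unique ∈plane⇒first
  where
  line : ℕ → ℕ → List Triple
  line x y = map (λ z → (x , y , z)) (upTo (suc s))
  plane : ℕ → List Triple
  plane x = concatMap (line x) (upTo (suc s))
  ∈line : ∀ {x y t} → t ∈ line x y → proj₁ t ≡ x × proj₁ (proj₂ t) ≡ y
  ∈line {x} {y} t∈ with _ , _ , refl ← ∈-map⁻ (λ z → (x , y , z)) t∈ = refl , refl
  plane-unique : ∀ x → Unique (plane x)
  plane-unique x = concatMap-unique (λ t → proj₁ (proj₂ t)) (line x) (upTo⁺ (suc s))
    (λ y → map⁺ (cong (λ t → proj₂ (proj₂ t))) (upTo⁺ (suc s))) (λ y t∈ → proj₂ (∈line t∈))
  ∈plane⇒first : ∀ x {t} → t ∈ plane x → proj₁ t ≡ x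
  ∈plane⇒first x t∈ with _ , _ , t∈′ ← find (∈-concatMap⁻ (line x) {xs = upTo (suc s)} t∈) = proj₁ (∈line t∈′)

∈-triples : ∀ s a b c → a ≤ s → b ≤ s → c ≤ s → (a , b , c) ∈ triples s
∈-triples s a b c a≤s b≤s c≤s =
  ∈-concatMap⁺ (λ x → concatMap (λ y → map (λ z → (x , y , z)) (upTo (suc s))) (upTo (suc s))) (lose (∈-upTo⁺ (s≤s a≤s))
    (∈-concatMap⁺ (λ y → map (λ z → (a , y , z)) (upTo (suc s))) (lose (∈-upTo⁺ (s≤s b≤s))
      (∈-map⁺ (λ z → (a , b , z)) (∈-upTo⁺ (s≤s c≤s))))))

≤-*-positive : ∀ a p → 1 ≤ p → a ≤ a * p
≤-*-positive a p 1≤p = subst (_≤ a * p) (*-identityʳ a) (*-monoʳ-≤ a 1≤p)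

coordinates≤ev : ∀ m a b c → a ≤ ev (suc m) (a , b , c) × b ≤ ev (suc m) (a , b , c) × c ≤ ev (suc m) (a , b , c)
coordinates≤ev m a b c =
  ≤-trans (≤-*-positive a n (s≤s z≤n)) (≤-trans (m≤m+n (a * n) (b * P)) (m≤m+n _ (c * Q))) ,
  ≤-trans (≤-*-positive b P (m+n≤o⇒m≤o∸n 1 3≤3n)) (≤-trans (m≤n+m (b * P) (a * n)) (m≤m+n _ (c * Q))) ,
  ≤-trans (≤-*-positive c Q (m+n≤o⇒m≤o∸n 1 (≤-trans (n≤1+n 2) 3≤3n))) (m≤n+m (c * Q) _)
  where
  n = suc m
  P = 3 * n ∸ 2
  Q = 3 * n ∸ 1
  3≤3n : 3 ≤ 3 * n
  3≤3n = *-monoʳ-≤ 3 (s≤s (z≤n {m}))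

factList-unique : ∀ n s → Unique (factList n s)
factList-unique n s = filter⁺ (λ t → ev n t ≟ s) (triples-unique s)

∈-factList⇔ : ∀ m s t → (t ∈ factList (suc m) s ⇔ IsFact (suc m) s t)
∈-factList⇔ m s (a , b , c) = mk⇔ (λ t∈ → proj₂ (∈-filter⁻ (λ t → ev (suc m) t ≟ s) {xs = triples s} t∈)) ∈factList
  where
  ∈factList : IsFact (suc m) s (a , b , c) → (a , b , c) ∈ factList (suc m) s
  ∈factList refl with a≤ , b≤ , c≤ ← coordinates≤ev m a b c =
    ∈-filter⁺ (λ t → ev (suc m) t ≟ s) (∈-triples _ a b c a≤ b≤ c≤) refl

×₃-≡ : ∀ {a b c a′ b′ c′ : ℕ} → a ≡ a′ → b ≡ b′ → c ≡ c′ → (a , b , c) ≡ (a′ , b′ , c′)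
×₃-≡ p q r = cong₂ _,_ p (cong₂ _,_ q r)

-- exchangeCount x y = 1 + min ⌊x / 3⌋ y
exchangeCount : ℕ → ℕ → ℕ
exchangeCount (suc (suc (suc x))) (suc y) = suc (exchangeCount x y)
exchangeCount _ _ = 1

exchanges : ℕ → ℕ → ℕ → List Triple
exchanges (suc (suc (suc x))) (suc y) z = (3 + x , suc y , z) ∷ exchanges x y (2 + z)
exchanges x y z = (x , y , z) ∷ []

length-exchanges : ∀ x y z → length (exchanges x y z) ≡ exchangeCount x y
length-exchanges (suc (suc (suc x))) (suc y) z = cong suc (length-exchanges x y (2 + z))
length-exchanges (suc (suc (suc x))) zero z = refl
length-exchanges zero y z = refl
length-exchanges (suc zero) y z = refl
length-exchanges (suc (suc zero)) y z = refl

exchange-refl : ∀ x y z → Exchange (x , y , z) (x , y , z)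
exchange-refl x y z = 0 , sym (+-identityʳ x) , sym (+-identityʳ y) , sym (+-identityʳ z)

∈-exchanges⁻ : ∀ x y z {t} → t ∈ exchanges x y z → Exchange (x , y , z) t
∈-exchanges⁻ (suc (suc (suc x))) (suc y) z (here refl) = exchange-refl _ _ _
∈-exchanges⁻ (suc (suc (suc x))) (suc y) z {a , b , c} (there t∈) with ∈-exchanges⁻ x y (2 + z) t∈
... | j , refl , refl , refl = suc j , three a j , sym (+-suc b j) , two z j
  where
  three : ∀ a j → 3 + (a + 3 * j) ≡ a + 3 * suc j
  three = solve-∀
  two : ∀ z j → 2 + z + 2 * j ≡ z + 2 * suc j
  two = solve-∀
∈-exchanges⁻ (suc (suc (suc x))) zero z (here refl) = exchange-refl _ _ _
∈-exchanges⁻ zero y z (here refl) = exchange-refl _ _ _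
∈-exchanges⁻ (suc zero) y z (here refl) = exchange-refl _ _ _
∈-exchanges⁻ (suc (suc zero)) y z (here refl) = exchange-refl _ _ _

self∈exchanges : ∀ x y z → (x , y , z) ∈ exchanges x y z
self∈exchanges (suc (suc (suc x))) (suc y) z = here refl
self∈exchanges (suc (suc (suc x))) zero z = here refl
self∈exchanges zero y z = here refl
self∈exchanges (suc zero) y z = here refl
self∈exchanges (suc (suc zero)) y z = here refl

∈-exchanges⁺ : ∀ x y z {t} → Exchange (x , y , z) t → t ∈ exchanges x y z
∈-exchanges⁺ x y z {a , b , c} (zero , ex , ey , ec) = subst (_∈ exchanges x y z)
  (×₃-≡ (trans ex (+-identityʳ a)) (trans ey (+-identityʳ b)) (sym (trans ec (+-identityʳ z)))) (self∈exchanges x y z)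
∈-exchanges⁺ x y z {a , b , c} (suc j , ex , ey , refl) with trans ex (three a j) | trans ey (+-suc b j)
  where
  three : ∀ a j → a + 3 * suc j ≡ 3 + (a + 3 * j)
  three = solve-∀
... | refl | refl = there (∈-exchanges⁺ (a + 3 * j) (b + j) (2 + z) (j , refl , refl , two z j))
  where
  two : ∀ z j → z + 2 * suc j ≡ 2 + z + 2 * j
  two = solve-∀

exchanges-unique : ∀ x y z → Unique (exchanges x y z)
exchanges-unique (suc (suc (suc x))) (suc y) z = tabulate head∉tail ∷ exchanges-unique x y (2 + z)
  where
  head∉tail : ∀ {t} → t ∈ exchanges x y (2 + z) → (3 + x , suc y , z) ≢ t
  head∉tail t∈ refl with j , _ , _ , z≡2+z+2j ← ∈-exchanges⁻ x y (2 + z) t∈ =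
    m≢1+m+n z (trans z≡2+z+2j (cong suc (sym (+-suc z (2 * j)))))
exchanges-unique (suc (suc (suc x))) zero z = [] ∷ []
exchanges-unique zero y z = [] ∷ []
exchanges-unique (suc zero) y z = [] ∷ []
exchanges-unique (suc (suc zero)) y z = [] ∷ []

into₂-list : ℕ → Triple → List Triple
into₂-list k (x , y , suc zero) with 3 * k ≤? suc x
... | yes _ = (suc x ∸ 3 * k , y + k + 1 , 0) ∷ []
... | no _  = []
into₂-list k _ = []

into₁-list : ℕ → Triple → List Triple
into₁-list k (x , y , suc zero) with y ≟ k
... | yes _ = (x + 3 * k + 2 , 0 , 0) ∷ []
... | no _  = []
into₁-list k _ = []

∈-into₂-list⁻ : ∀ k x y z {t} → t ∈ into₂-list k (x , y , z) → Into₂ k (x , y , z) t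
∈-into₂-list⁻ k x y (suc zero) t∈ with 3 * k ≤? suc x
∈-into₂-list⁻ k x y (suc zero) (here refl) | yes 3k≤1+x = refl , refl , trans (+-comm x 1) (sym (m∸n+n≡m 3k≤1+x)) , refl

∈-into₂-list⁺ : ∀ k x y z {t} → Into₂ k (x , y , z) t → t ∈ into₂-list k (x , y , z)
∈-into₂-list⁺ k x y z {a , _ , _} (refl , refl , x+1≡a+3k , refl) with 3 * k ≤? suc x
... | yes _ = here (cong (λ v → (v , y + k + 1 , 0)) a≡)
  where
  a≡ : a ≡ suc x ∸ 3 * k
  a≡ = sym (trans (cong (_∸ 3 * k) (trans (+-comm 1 x) x+1≡a+3k)) (m+n∸n≡m a (3 * k)))
... | no 3k≰1+x = ⊥-elim (3k≰1+x (subst (3 * k ≤_) (sym (trans (+-comm 1 x) x+1≡a+3k)) (m≤n+m (3 * k) a)))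

∈-into₁-list⁻ : ∀ k x y z {t} → t ∈ into₁-list k (x , y , z) → Into₁ k (x , y , z) t
∈-into₁-list⁻ k x y (suc zero) t∈ with y ≟ k
∈-into₁-list⁻ k x y (suc zero) (here refl) | yes y≡k = y≡k , refl , refl , refl , refl

∈-into₁-list⁺ : ∀ k x y z {t} → Into₁ k (x , y , z) t → t ∈ into₁-list k (x , y , z)
∈-into₁-list⁺ k x y z (refl , refl , refl , refl , refl) with k ≟ k
... | yes _    = here refl
... | no k≢k   = ⊥-elim (k≢k refl)

trades : ℕ → Triple → List Triple
trades k (x , y , z) = exchanges x y z ++ into₂-list k (x , y , z) ++ into₁-list k (x , y , z)

∈-trades⇔ : ∀ k u t → (t ∈ trades k u ⇔ Trade k u t)
∈-trades⇔ k (x , y , z) t = mk⇔ to from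
  where
  to : t ∈ trades k (x , y , z) → Trade k (x , y , z) t
  to t∈ with ∈-++⁻ (exchanges x y z) t∈
  ... | inj₁ t∈e = exchange (∈-exchanges⁻ x y z t∈e)
  ... | inj₂ t∈i with ∈-++⁻ (into₂-list k (x , y , z)) t∈i
  ...   | inj₁ t∈₂ = into₂ (∈-into₂-list⁻ k x y z t∈₂)
  ...   | inj₂ t∈₁ = into₁ (∈-into₁-list⁻ k x y z t∈₁)
  from : Trade k (x , y , z) t → t ∈ trades k (x , y , z)
  from (exchange e) = ∈-++⁺ˡ (∈-exchanges⁺ x y z e)
  from (into₂ i)    = ∈-++⁺ʳ (exchanges x y z) (∈-++⁺ˡ (∈-into₂-list⁺ k x y z i))
  from (into₁ i)    = ∈-++⁺ʳ (exchanges x y z) (∈-++⁺ʳ (into₂-list k (x , y , z)) (∈-into₁-list⁺ k x y z i))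

exchange-disjoint-into₂ : ∀ k u t → Exchange u t → Into₂ k u t → ⊥
exchange-disjoint-into₂ k (x , y , z) (a , b , c) (j , _ , y≡b+j , _) (_ , _ , _ , refl) =
  m≢1+m+n y (trans y≡b+j (shift y k j))
  where
  shift : ∀ y k j → y + k + 1 + j ≡ suc (y + (k + j))
  shift = solve-∀

exchange-disjoint-into₁ : ∀ k u t → Exchange u t → Into₁ k u t → ⊥
exchange-disjoint-into₁ k (x , y , z) (a , b , c) (j , x≡a+3j , _ , _) (_ , _ , _ , _ , refl) =
  m≢1+m+n x (trans x≡a+3j (shift x k j))
  where
  shift : ∀ x k j → x + 3 * k + 2 + 3 * j ≡ suc (x + suc (3 * k + 3 * j))
  shift = solve-∀

into₂-disjoint-into₁ : ∀ k u t → Into₂ k u t → Into₁ k u t → ⊥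
into₂-disjoint-into₁ k (x , y , z) (a , b , c) (_ , _ , _ , b≡) (_ , _ , refl , _ , _) = m+1+n≢0 (y + k) (sym b≡)

into₂-list-unique : ∀ k u → Unique (into₂-list k u)
into₂-list-unique k (x , y , zero) = []
into₂-list-unique k (x , y , suc (suc z)) = []
into₂-list-unique k (x , y , suc zero) with 3 * k ≤? suc x
... | yes _ = [] ∷ []
... | no _  = []

into₁-list-unique : ∀ k u → Unique (into₁-list k u)
into₁-list-unique k (x , y , zero) = []
into₁-list-unique k (x , y , suc (suc z)) = []
into₁-list-unique k (x , y , suc zero) with y ≟ k
... | yes _ = [] ∷ []
... | no _  = []

trades-unique : ∀ k u → Unique (trades k u)
trades-unique k u@(x , y , z) =
  ++⁺ (exchanges-unique x y z) (++⁺ (into₂-list-unique k u) (into₁-list-unique k u) into-disjoint) exchanges-disjoint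
  where
  into-disjoint : ∀ {t} → ¬ (t ∈ into₂-list k u × t ∈ into₁-list k u)
  into-disjoint {t} (t∈₂ , t∈₁) = into₂-disjoint-into₁ k u t (∈-into₂-list⁻ k x y z t∈₂) (∈-into₁-list⁻ k x y z t∈₁)
  exchanges-disjoint : ∀ {t} → ¬ (t ∈ exchanges x y z × t ∈ into₂-list k u ++ into₁-list k u)
  exchanges-disjoint {t} (t∈e , t∈i) with ∈-++⁻ (into₂-list k u) t∈i
  ... | inj₁ t∈₂ = exchange-disjoint-into₂ k u t (∈-exchanges⁻ x y z t∈e) (∈-into₂-list⁻ k x y z t∈₂)
  ... | inj₂ t∈₁ = exchange-disjoint-into₁ k u t (∈-exchanges⁻ x y z t∈e) (∈-into₁-list⁻ k x y z t∈₁)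

numFact≡length-trades : ∀ k u → 1 ≤ k → Reduced k u → numFact (suc (2 * k)) (ev (suc (2 * k)) u) ≡ length (trades k u)
numFact≡length-trades k u k≥1 red =
  ↭-length (∼bag⇒↭ (unique∧set⇒bag (factList-unique n s) (trades-unique k u) (mk⇔ to from)))
  where
  n = suc (2 * k)
  s = ev n u
  to : ∀ {t} → t ∈ factList n s → t ∈ trades k u
  to {t} t∈ = Equivalence.from (∈-trades⇔ k u t) (ev≡⇒trade k t u k≥1 red (Equivalence.to (∈-factList⇔ (2 * k) s t) t∈))
  from : ∀ {t} → t ∈ trades k u → t ∈ factList n s
  from {t} t∈ = Equivalence.from (∈-factList⇔ (2 * k) s t) (trade⇒ev≡ (Equivalence.to (∈-trades⇔ k u t) t∈))

-- Monotonicity of the trade counts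

length-trades : ∀ k x y z → length (trades k (x , y , z))
                          ≡ exchangeCount x y + (length (into₂-list k (x , y , z)) + length (into₁-list k (x , y , z)))
length-trades k x y z = trans (length-++ (exchanges x y z)) (cong₂ _+_ (length-exchanges x y z) (length-++ (into₂-list k (x , y , z))))

exchangeCount-positive : ∀ x y → 1 ≤ exchangeCount x y
exchangeCount-positive (suc (suc (suc x))) (suc y) = s≤s z≤n
exchangeCount-positive (suc (suc (suc x))) zero = s≤s z≤n
exchangeCount-positive zero y = s≤s z≤n
exchangeCount-positive (suc zero) y = s≤s z≤n
exchangeCount-positive (suc (suc zero)) y = s≤s z≤n

exchangeCount-mono : ∀ {x′ y′ x y} → x′ ≤ x → y′ ≤ y → exchangeCount x′ y′ ≤ exchangeCount x y
exchangeCount-mono {suc (suc (suc x′))} {suc y′} (s≤s (s≤s (s≤s x′≤x))) (s≤s y′≤y) = s≤s (exchangeCount-mono x′≤x y′≤y)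
exchangeCount-mono {suc (suc (suc x′))} {zero} {x} {y} _ _ = exchangeCount-positive x y
exchangeCount-mono {zero} {_} {x} {y} _ _ = exchangeCount-positive x y
exchangeCount-mono {suc zero} {_} {x} {y} _ _ = exchangeCount-positive x y
exchangeCount-mono {suc (suc zero)} {_} {x} {y} _ _ = exchangeCount-positive x y

exchangeCount-strict : ∀ {x′ y′ x y} → 3 + x′ ≤ x → suc y′ ≤ y → exchangeCount x′ y′ < exchangeCount x y
exchangeCount-strict {x′} {y′} {suc (suc (suc x))} {suc y} (s≤s (s≤s (s≤s x′≤x))) (s≤s y′≤y) = s≤s (exchangeCount-mono x′≤x y′≤y)

<-exchangeCount : ∀ a b j → j < exchangeCount (a + 3 * j) (b + j)
<-exchangeCount a b zero = exchangeCount-positive _ _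
<-exchangeCount a b (suc j) = subst₂ (λ p q → suc j < exchangeCount p q) (sym (three a j)) (sym (+-suc b j)) (s≤s (<-exchangeCount a b j))
  where
  three : ∀ a j → a + 3 * suc j ≡ 3 + (a + 3 * j)
  three = solve-∀

exchangeCount-> : ∀ j x y → j < exchangeCount x y → ∃[ a ] ∃[ b ] x ≡ a + 3 * j × y ≡ b + j
exchangeCount-> zero x y _ = x , y , sym (+-identityʳ x) , sym (+-identityʳ y)
exchangeCount-> (suc j) (suc (suc (suc x))) (suc y) (s≤s j<count) with a , b , refl , refl ← exchangeCount-> j x y j<count =
  a , b , three a j , sym (+-suc b j)
  where
  three : ∀ a j → 3 + (a + 3 * j) ≡ a + 3 * suc j
  three = solve-∀
exchangeCount-> (suc j) (suc (suc (suc x))) zero (s≤s ())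
exchangeCount-> (suc j) zero y (s≤s ())
exchangeCount-> (suc j) (suc zero) y (s≤s ())
exchangeCount-> (suc j) (suc (suc zero)) y (s≤s ())

length-into₂-list-mono : ∀ k {x′ y′ z′ x y z} → x′ ≤ x → z′ ≤ z → z ≤ 1 →
                         length (into₂-list k (x′ , y′ , z′)) ≤ length (into₂-list k (x , y , z))
length-into₂-list-mono k {z′ = zero} _ _ _ = z≤n
length-into₂-list-mono k {z′ = suc (suc _)} _ _ _ = z≤n
length-into₂-list-mono k {z′ = suc zero} {z = suc (suc _)} _ _ (s≤s ())
length-into₂-list-mono k {x′} {z′ = suc zero} {x} {z = suc zero} x′≤x _ _ with 3 * k ≤? suc x′ | 3 * k ≤? suc x
... | no _ | _ = z≤n
... | yes _ | yes _ = ≤-refl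
... | yes 3k≤1+x′ | no 3k≰1+x = ⊥-elim (3k≰1+x (≤-trans 3k≤1+x′ (s≤s x′≤x)))

length-into₁-list-mono : ∀ k {x′ y′ z′ x y z} → y′ ≤ y → y ≤ k → z′ ≤ z → z ≤ 1 →
                         length (into₁-list k (x′ , y′ , z′)) ≤ length (into₁-list k (x , y , z))
length-into₁-list-mono k {z′ = zero} _ _ _ _ = z≤n
length-into₁-list-mono k {z′ = suc (suc _)} _ _ _ _ = z≤n
length-into₁-list-mono k {z′ = suc zero} {z = suc (suc _)} _ _ _ (s≤s ())
length-into₁-list-mono k {y′ = y′} {z′ = suc zero} {y = y} {z = suc zero} y′≤y y≤k _ _ with y′ ≟ k | y ≟ k
... | no _ | _ = z≤n
... | yes _ | yes _ = ≤-refl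
... | yes refl | no y≢k = ⊥-elim (y≢k (≤-antisym y≤k y′≤y))

≤-+-≡⇒≡ : ∀ {a′ b′ a b} → a′ ≤ a → b′ ≤ b → a′ + b′ ≡ a + b → a′ ≡ a × b′ ≡ b
≤-+-≡⇒≡ {a′} {b′} {a} {b} a′≤a b′≤b e = a′≡a , +-cancelˡ-≡ a′ b′ b (trans e (cong (_+ b) (sym a′≡a)))
  where
  a′≡a : a′ ≡ a
  a′≡a = ≤-antisym a′≤a (+-cancelʳ-≤ b′ a a′ (subst (a + b′ ≤_) (sym e) (+-monoʳ-≤ a b′≤b)))

≤-+-+-≡⇒≡ : ∀ {a′ b′ c′ a b c} → a′ ≤ a → b′ ≤ b → c′ ≤ c → a′ + (b′ + c′) ≡ a + (b + c) → a′ ≡ a × b′ ≡ b × c′ ≡ c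
≤-+-+-≡⇒≡ a′≤a b′≤b c′≤c e with a′≡a , rest≡ ← ≤-+-≡⇒≡ a′≤a (+-mono-≤ b′≤b c′≤c) e = a′≡a , ≤-+-≡⇒≡ b′≤b c′≤c rest≡

SameTradeCounts : ℕ → Triple → Triple → Set
SameTradeCounts k u′@(x′ , y′ , _) u@(x , y , _) =
  exchangeCount x′ y′ ≡ exchangeCount x y ×
  length (into₂-list k u′) ≡ length (into₂-list k u) ×
  length (into₁-list k u′) ≡ length (into₁-list k u)

same-length⇒same-trade-counts : ∀ k u′ u → u′ ≤₃ u → Reduced k u → length (trades k u′) ≡ length (trades k u) →
                                SameTradeCounts k u′ u
same-length⇒same-trade-counts k u′@(x′ , y′ , z′) u@(x , y , z) (x′≤x , y′≤y , z′≤z) (_ , y≤k , z≤1) e =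
  ≤-+-+-≡⇒≡ (exchangeCount-mono x′≤x y′≤y)
             (length-into₂-list-mono k {y′ = y′} {y = y} x′≤x z′≤z z≤1)
             (length-into₁-list-mono k {x′ = x′} {x = x} y′≤y y≤k z′≤z z≤1)
             (trans (sym (length-trades k x′ y′ z′)) (trans e (length-trades k x y z)))

-- Lifting trades to a smaller normal form

UniqueTradeBelow : ℕ → Triple → Triple → Set
UniqueTradeBelow k u′ ζ = Σ Triple λ ζ′ → (Trade k u′ ζ′ × ζ′ <₃ ζ) × (∀ ζ″ → Trade k u′ ζ″ → ζ″ ≤₃ ζ → ζ″ ≡ ζ′)

nonempty-resp-length : ∀ {A : Set} {xs ys : List A} {y} → length xs ≡ length ys → y ∈ ys → ∃[ x ] x ∈ xs
nonempty-resp-length {xs = x ∷ _} _ _ = x , here refl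
nonempty-resp-length {xs = []} eq y∈ys = ⊥-elim (<-irrefl eq (∈-length y∈ys))

exchange-raises-third : ∀ u t → Exchange u t → proj₂ (proj₂ u) ≤ proj₂ (proj₂ t)
exchange-raises-third (_ , _ , z) _ (j , _ , _ , refl) = m≤m+n z (2 * j)

into₂-functional : ∀ k u t t′ → Into₂ k u t → Into₂ k u t′ → t ≡ t′
into₂-functional k (x , y , _) (a , _ , _) (a′ , _ , _) (_ , refl , x+1≡a+3k , refl) (_ , refl , x+1≡a′+3k , refl) =
  cong (λ v → (v , y + k + 1 , 0)) (+-cancelʳ-≡ (3 * k) a a′ (trans (sym x+1≡a+3k) x+1≡a′+3k))

into₁-functional : ∀ k u t t′ → Into₁ k u t → Into₁ k u t′ → t ≡ t′
into₁-functional k _ _ _ (_ , _ , refl , refl , refl) (_ , _ , refl , refl , refl) = refl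

below-into₁ : ∀ k u′ u ζ → u′ <₃ u → length (into₁-list k u′) ≡ length (into₁-list k u) → Into₁ k u ζ →
              UniqueTradeBelow k u′ ζ
below-into₁ k u′@(x′ , y′ , z′) u@(x , y , z) ζ ((x′≤x , _ , _) , u′≢u) count≡ ι
  with t′ , t′∈ ← nonempty-resp-length count≡ (∈-into₁-list⁺ k x y z {ζ} ι)
  with ι′ ← ∈-into₁-list⁻ k x′ y′ z′ t′∈
  with refl , refl , refl , refl , refl ← ι | refl , refl , refl , refl , refl ← ι′ =
  t′ , (into₁ ι′ , (+-monoˡ-≤ 2 (+-monoˡ-≤ (3 * k) x′≤x) , z≤n , z≤n) , t′≢ζ) , unique
  where
  t′≢ζ : t′ ≢ ζ
  t′≢ζ t′≡ζ = u′≢u (cong (λ v → (v , k , 1)) (+-cancelʳ-≡ (3 * k) x′ x (+-cancelʳ-≡ 2 _ _ (,-injectiveˡ t′≡ζ))))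
  unique : ∀ ζ″ → Trade k u′ ζ″ → ζ″ ≤₃ ζ → ζ″ ≡ t′
  unique ζ″ (exchange ε) (_ , _ , c″≤0) with () ← ≤-trans (exchange-raises-third u′ ζ″ ε) c″≤0
  unique ζ″ (into₂ (_ , _ , _ , refl)) (_ , b″≤0 , _) = ⊥-elim (m+1+n≰m 0 (subst (_≤ 0) (+-comm (k + k) 1) b″≤0))
  unique ζ″ (into₁ ι″) _ = into₁-functional k u′ ζ″ t′ ι″ ι′

below-into₂ : ∀ k u′ u ζ → Reduced k u → u′ <₃ u → length (into₂-list k u′) ≡ length (into₂-list k u) → Into₂ k u ζ →
              UniqueTradeBelow k u′ ζ
below-into₂ k u′@(x′ , y′ , z′) u@(x , y , z) ζ@(a , _ , _) (x≤3k , _ , _) ((x′≤x , y′≤y , _) , u′≢u) count≡ ι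
  with t′ , t′∈ ← nonempty-resp-length count≡ (∈-into₂-list⁺ k x y z {ζ} ι)
  with ι′ ← ∈-into₂-list⁻ k x′ y′ z′ t′∈
  with refl , refl , x+1≡a+3k , refl ← ι
  with t′@(a′ , _ , _) ← t′
  with refl , refl , x′+1≡a′+3k , refl ← ι′ =
  t′ , (into₂ ι′ , (a′≤a , +-monoˡ-≤ 1 (+-monoˡ-≤ k y′≤y) , z≤n) , t′≢ζ) , unique
  where
  a′≤a : a′ ≤ a
  a′≤a = +-cancelʳ-≤ (3 * k) a′ a (subst₂ _≤_ x′+1≡a′+3k x+1≡a+3k (+-monoˡ-≤ 1 x′≤x))
  t′≢ζ : t′ ≢ ζ
  t′≢ζ t′≡ζ = u′≢u (×₃-≡ x′≡x y′≡y refl)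
    where
    x′≡x = +-cancelʳ-≡ 1 x′ x (trans x′+1≡a′+3k (trans (cong (_+ 3 * k) (,-injectiveˡ t′≡ζ)) (sym x+1≡a+3k)))
    y′≡y = +-cancelʳ-≡ k y′ y (+-cancelʳ-≡ 1 _ _ (,-injectiveˡ (,-injectiveʳ t′≡ζ)))
  a≤1 : a ≤ 1
  a≤1 = +-cancelʳ-≤ (3 * k) a 1 (subst₂ _≤_ x+1≡a+3k (+-comm (3 * k) 1) (+-monoˡ-≤ 1 x≤3k))
  unique : ∀ ζ″ → Trade k u′ ζ″ → ζ″ ≤₃ ζ → ζ″ ≡ t′
  unique ζ″ (exchange ε) (_ , _ , c″≤0) with () ← ≤-trans (exchange-raises-third u′ ζ″ ε) c″≤0
  unique ζ″ (into₂ ι″) _ = into₂-functional k u′ ζ″ t′ ι″ ι′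
  unique ζ″ (into₁ (_ , _ , _ , _ , refl)) (a″≤a , _ , _) with s≤s () ← ≤-trans (≤-trans (m≤n+m 2 (x′ + 3 * k)) a″≤a) a≤1

below-exchange : ∀ k x′ y′ z′ x y z ζ → Reduced k (x , y , z) → (x′ , y′ , z′) <₃ (x , y , z) →
                 exchangeCount x′ y′ ≡ exchangeCount x y → Exchange (x , y , z) ζ → UniqueTradeBelow k (x′ , y′ , z′) ζ
below-exchange k x′ y′ z′ x y z ζ@(a , b , _) (x≤3k , y≤k , z≤1) ((x′≤x , y′≤y , z′≤z) , u′≢u) count≡ (j , refl , refl , refl)
  with a′ , b′ , refl , refl ← exchangeCount-> j x′ y′ (subst (j <_) (sym count≡) (<-exchangeCount a b j)) =
  t′ , (exchange (j , refl , refl , refl) , (a′≤a , b′≤b , +-monoˡ-≤ (2 * j) z′≤z) , t′≢ζ) , unique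
  where
  t′ = (a′ , b′ , z′ + 2 * j)
  a′≤a = +-cancelʳ-≤ (3 * j) a′ a x′≤x
  b′≤b = +-cancelʳ-≤ j b′ b y′≤y
  t′≢ζ : t′ ≢ ζ
  t′≢ζ t′≡ζ = u′≢u (×₃-≡ (cong (_+ 3 * j) (,-injectiveˡ t′≡ζ)) (cong (_+ j) (,-injectiveˡ (,-injectiveʳ t′≡ζ)))
                         (+-cancelʳ-≡ (2 * j) z′ z (,-injectiveʳ (,-injectiveʳ t′≡ζ))))
  same-exchange : ∀ {a″ b″} l → a′ + 3 * j ≡ a″ + 3 * l → b′ + j ≡ b″ + l → a″ ≤ a → b″ ≤ b → z′ + 2 * l ≤ z + 2 * j →
                  (a″ , b″ , z′ + 2 * l) ≡ t′
  same-exchange {a″} {b″} l ex ey a″≤a b″≤b c″≤c with <-cmp l j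
  ... | tri≈ _ refl _ = ×₃-≡ (+-cancelʳ-≡ (3 * l) a″ a′ (sym ex)) (+-cancelʳ-≡ l b″ b′ (sym ey)) refl
  ... | tri< l<j _ _ = ⊥-elim (<-irrefl count≡ (exchangeCount-strict 3+x′≤x 1+y′≤y))
    where
    3+x′≤x : 3 + (a′ + 3 * j) ≤ a + 3 * j
    3+x′≤x = begin
      3 + (a′ + 3 * j)   ≡⟨ cong (3 +_) ex ⟩
      3 + (a″ + 3 * l)   ≤⟨ +-monoʳ-≤ 3 (+-monoˡ-≤ (3 * l) a″≤a) ⟩
      3 + (a + 3 * l)    ≡⟨ solve (a ∷ l ∷ []) ⟩
      a + 3 * suc l      ≤⟨ +-monoʳ-≤ a (*-monoʳ-≤ 3 l<j) ⟩
      a + 3 * j          ∎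
      where open ≤-Reasoning
    1+y′≤y : suc (b′ + j) ≤ b + j
    1+y′≤y = begin
      suc (b′ + j)   ≡⟨ cong suc ey ⟩
      suc (b″ + l)   ≤⟨ s≤s (+-monoˡ-≤ l b″≤b) ⟩
      suc (b + l)    ≡⟨ sym (+-suc b l) ⟩
      b + suc l      ≤⟨ +-monoʳ-≤ b l<j ⟩
      b + j          ∎
      where open ≤-Reasoning
  ... | tri> _ _ j<l = ⊥-elim (<-irrefl refl (begin-strict
      z + 2 * j           ≤⟨ +-monoˡ-≤ (2 * j) z≤1 ⟩
      1 + 2 * j           <⟨ ≤-reflexive (solve (j ∷ [])) ⟩
      2 * suc j           ≤⟨ *-monoʳ-≤ 2 j<l ⟩
      2 * l               ≤⟨ m≤n+m (2 * l) z′ ⟩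
      z′ + 2 * l          ≤⟨ c″≤c ⟩
      z + 2 * j           ∎))
    where open ≤-Reasoning
  unique : ∀ ζ″ → Trade k (a′ + 3 * j , b′ + j , z′) ζ″ → ζ″ ≤₃ ζ → ζ″ ≡ t′
  unique _ (exchange (l , ex , ey , refl)) (a″≤a , b″≤b , c″≤c) = same-exchange l ex ey a″≤a b″≤b c″≤c
  unique _ (into₂ (_ , _ , _ , refl)) (_ , b″≤b , _) =
    ⊥-elim (m+1+n≰m k (subst (_≤ k) (shift b′ j k) (≤-trans b″≤b (≤-trans (m≤m+n b j) y≤k))))
    where
    shift : ∀ b′ j k → b′ + j + k + 1 ≡ k + suc (b′ + j)
    shift = solve-∀
  unique _ (into₁ (_ , _ , _ , _ , refl)) (a″≤a , _ , _) =
    ⊥-elim (m+1+n≰m (3 * k) (subst (_≤ 3 * k) (shift a′ j k) (≤-trans a″≤a (≤-trans (m≤m+n a (3 * j)) x≤3k))))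
    where
    shift : ∀ a′ j k → a′ + 3 * j + 3 * k + 2 ≡ 3 * k + suc (suc (a′ + 3 * j))
    shift = solve-∀

trade-below-reduced : ∀ k u u′ ζ → Reduced k u → Trade k u′ ζ → ζ ≤₃ u → ζ ≡ u′
trade-below-reduced k _ _ (a , b , c) _ (exchange (zero , x′≡a+0 , y′≡b+0 , c≡z′+0)) _ =
  ×₃-≡ (sym (trans x′≡a+0 (+-identityʳ a))) (sym (trans y′≡b+0 (+-identityʳ b))) (trans c≡z′+0 (+-identityʳ _))
trade-below-reduced k _ (_ , _ , z′) _ (_ , _ , z≤1) (exchange (suc j , _ , _ , refl)) (_ , _ , c≤z)
  with s≤s () ← ≤-trans (≤-trans (*-monoʳ-≤ 2 (s≤s (z≤n {j}))) (m≤n+m (2 * suc j) z′)) (≤-trans c≤z z≤1)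
trade-below-reduced k _ (_ , y′ , _) _ (_ , y≤k , _) (into₂ (_ , _ , _ , refl)) (_ , b≤y , _) =
  ⊥-elim (m+1+n≰m k (subst (_≤ k) (shift y′ k) (≤-trans b≤y y≤k)))
  where
  shift : ∀ y′ k → y′ + k + 1 ≡ k + suc y′
  shift = solve-∀
trade-below-reduced k _ (x′ , _ , _) _ (x≤3k , _ , _) (into₁ (_ , _ , _ , _ , refl)) (a≤x , _ , _) =
  ⊥-elim (m+1+n≰m (3 * k) (subst (_≤ 3 * k) (shift x′ k) (≤-trans a≤x x≤3k)))
  where
  shift : ∀ x′ k → x′ + 3 * k + 2 ≡ 3 * k + suc (suc x′)
  shift = solve-∀

UniqueFactorizationBelow : ℕ → ℕ → Triple → Set
UniqueFactorizationBelow n s ζ =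
  Σ Triple (λ ζ′ → (IsFact n s ζ′ × ζ′ <₃ ζ) × ((ζ″ : Triple) → IsFact n s ζ″ → ζ″ <₃ ζ → ζ″ ≡ ζ′))

unique-trade-below⇒unique-factorization-below : ∀ k u′ ζ → 1 ≤ k → Reduced k u′ → UniqueTradeBelow k u′ ζ →
                                                 UniqueFactorizationBelow (suc (2 * k)) (ev (suc (2 * k)) u′) ζ
unique-trade-below⇒unique-factorization-below k u′ ζ k≥1 red (ζ′ , (τ , ζ′<ζ) , unique) =
  ζ′ , (trade⇒ev≡ τ , ζ′<ζ) , λ ζ″ fact″ ζ″<ζ → unique ζ″ (ev≡⇒trade k ζ″ u′ k≥1 red fact″) (proj₁ ζ″<ζ)

unique-trade-below : ∀ k u′ u ζ → Reduced k u → u′ <₃ u → SameTradeCounts k u′ u → Trade k u ζ → UniqueTradeBelow k u′ ζ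
unique-trade-below k (x′ , y′ , z′) (x , y , z) ζ red u′<u (exchanges≡ , _ , _) (exchange ε) =
  below-exchange k x′ y′ z′ x y z ζ red u′<u exchanges≡ ε
unique-trade-below k u′ u ζ red u′<u (_ , into₂≡ , _) (into₂ ι) = below-into₂ k u′ u ζ red u′<u into₂≡ ι
unique-trade-below k u′ u ζ red u′<u (_ , _ , into₁≡) (into₁ ι) = below-into₁ k u′ u ζ u′<u into₁≡ ι

<₃⇔unique-factorizations-below : ∀ k u′ u → 1 ≤ k → Reduced k u′ → Reduced k u →
  numFact (suc (2 * k)) (ev (suc (2 * k)) u′) ≡ numFact (suc (2 * k)) (ev (suc (2 * k)) u) →
  (u′ <₃ u ⇔ (∀ ζ → IsFact (suc (2 * k)) (ev (suc (2 * k)) u) ζ →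
               UniqueFactorizationBelow (suc (2 * k)) (ev (suc (2 * k)) u′) ζ))
<₃⇔unique-factorizations-below k u′ u k≥1 red′ red numFact≡ = mk⇔ to from
  where
  to : u′ <₃ u → ∀ ζ → IsFact (suc (2 * k)) (ev (suc (2 * k)) u) ζ → UniqueFactorizationBelow (suc (2 * k)) (ev (suc (2 * k)) u′) ζ
  to u′<u ζ fact = unique-trade-below⇒unique-factorization-below k u′ ζ k≥1 red′
    (unique-trade-below k u′ u ζ red u′<u counts (ev≡⇒trade k ζ u k≥1 red fact))
    where
    counts = same-length⇒same-trade-counts k u′ u (proj₁ u′<u) red
      (trans (sym (numFact≡length-trades k u′ k≥1 red′)) (trans numFact≡ (numFact≡length-trades k u k≥1 red)))
  from : (∀ ζ → IsFact (suc (2 * k)) (ev (suc (2 * k)) u) ζ → UniqueFactorizationBelow (suc (2 * k)) (ev (suc (2 * k)) u′) ζ) →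
         u′ <₃ u
  from below with ζ′ , (fact′ , ζ′<u) , _ ← below u refl =
    subst (_<₃ u) (trade-below-reduced k u u′ ζ′ red (ev≡⇒trade k ζ′ u′ k≥1 red′ fact′) (proj₁ ζ′<u)) ζ′<u

IsNF⇒Reduced : ∀ k s u → IsNF (suc (2 * k)) s u → Reduced k u
IsNF⇒Reduced k s (x , y , z) (_ , z<2 , 2y<n+1 , 2x<3n∸1) = x≤3k , y≤k , ≤-pred z<2
  where
  y≤k = ≤-pred (*-cancelˡ-< 2 y (suc k) (subst (2 * y <_) (identity k) 2y<n+1))
    where
    identity : ∀ k → suc (2 * k) + 1 ≡ 2 * suc k
    identity = solve-∀
  x≤3k = ≤-pred (*-cancelˡ-< 2 x (suc (3 * k)) (subst (2 * x <_) (cong (_∸ 1) (identity k)) 2x<3n∸1))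
    where
    identity : ∀ k → 3 * suc (2 * k) ≡ suc (2 * suc (3 * k))
    identity = solve-∀

mainTheorem9 : (n k f i s s' : ℕ) → n ≡ 2 * k + 1 → 5 ≤ n → IsFrobenius n f → 1 ≤ i →
    InM n f i s → InM n f i s' → (u u' : Triple) → IsNF n s u → IsNF n s' u' →
    (u' <₃ u ⇔ ((ζ : Triple) → IsFact n s ζ →
      Σ Triple (λ ζ' → (IsFact n s' ζ' × ζ' <₃ ζ) × ((ζ'' : Triple) → IsFact n s' ζ'' → ζ'' <₃ ζ → ζ'' ≡ ζ'))))
mainTheorem9 n k f i s s' n≡2k+1 5≤n _ _ (_ , #s≡i) (_ , #s′≡i) u@(_ , _ , _) u′@(_ , _ , _) nf nf′
  with refl ← trans n≡2k+1 (+-comm (2 * k) 1) | refl ← proj₁ nf | refl ← proj₁ nf′ =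
  <₃⇔unique-factorizations-below k u′ u (1≤k 5≤n) (IsNF⇒Reduced k _ u′ nf′) (IsNF⇒Reduced k _ u nf) (trans #s′≡i (sym #s≡i))
  where
  1≤k : ∀ {k} → 5 ≤ suc (2 * k) → 1 ≤ k
  1≤k {zero} (s≤s ())
  1≤k {suc _} _ = s≤s z≤n
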